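{- For every arrangement $\sigma$ and window size $w$, in the iteration of \textsc{Window Sort} on $\sigma$ with window size $w$, every element $x$ satisfies $|computed\_rank(x)-\sigma'(x)|\le 2w$.
   Context: Elements are $\{1,\dots,n\}$, identified with their true ranks; comparisons are recurrent (each pair's outcome is fixed, possibly erroneous). $\sigma(x)$ is the position of $x$. \textsc{Window Sort} iteration with window size $w$ on $\sigma$: for each element $x$, with $l=\sigma(x)$, $wins(x)$ is the number of elements $y$ with $\sigma(y)\in[l-2w,l-1]\cup[l+1,l+2w]$ for which the comparison reports $x>y$, and $computed\_rank(x)=\max\{l-2w,0\}+wins(x)$. Then $\sigma'$ is obtained by placing the elements in order of non-decreasing computed rank, ties broken arbitrarily; $\sigma'(x)$ is the position of $x$ in $\sigma'$. -}

module Defs where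

open import Data.Nat using (ℕ; suc; _+_; _*_; _∸_; _≤_; _≟_; _≤?_)
open import Data.Fin using (Fin; toℕ)
open import Data.Bool using (Bool; true; false; T)
open import Data.List using (length; filter; allFin)
open import Data.Product using (_×_)
open import Relation.Nullary using (¬_; Dec; _×-dec_; ¬?)
open import Relation.Nullary.Decidable using (T?)
open import Relation.Binary.PropositionalEquality using (_≡_)
open import Function.Bundles using (_↔_; Inverse)

-- Elements are Fin n (identified with their true ranks).
-- A (recurrent) comparison outcome: `gt x y ≡ true` means the comparison
-- of the pair {x,y} reports x > y.  Each pair's outcome is fixed.
Comparison : ℕ → Set
Comparison n = Fin n → Fin n → Bool

Consistent : {n : ℕ} → Comparison n → Set
Consistent {n} gt = ∀ (x y : Fin n) → ¬ (x ≡ y) → gt y x ≡ Data.Bool.not (gt x y)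
  where import Data.Bool

-- An arrangement: a bijection from elements to positions.
Arrangement : ℕ → Set
Arrangement n = Fin n ↔ Fin n

pos : {n : ℕ} → Arrangement n → Fin n → ℕ
pos σ x = suc (toℕ (Inverse.to σ x))

InWindow : {n : ℕ} → Arrangement n → ℕ → Fin n → Fin n → Set
InWindow σ w x y =
  ¬ (pos σ y ≡ pos σ x) × (pos σ x ≤ pos σ y + 2 * w) × (pos σ y ≤ pos σ x + 2 * w)

inWindow? : {n : ℕ} (σ : Arrangement n) (w : ℕ) (x y : Fin n) → Dec (InWindow σ w x y)
inWindow? σ w x y =
  ¬? (pos σ y ≟ pos σ x) ×-dec (pos σ x ≤? pos σ y + 2 * w) ×-dec (pos σ y ≤? pos σ x + 2 * w)

wins : {n : ℕ} → Comparison n → Arrangement n → ℕ → Fin n → ℕ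
wins {n} gt σ w x =
  length (filter (λ y → inWindow? σ w x y ×-dec T? (gt x y)) (allFin n))

-- computed_rank(x) = max{l - 2w, 0} + wins(x)   (truncated subtraction on ℕ)
computedRank : {n : ℕ} → Comparison n → Arrangement n → ℕ → Fin n → ℕ
computedRank gt σ w x = (pos σ x ∸ 2 * w) + wins gt σ w x

-- σ' is a result of the Window Sort iteration: elements placed in order of
-- non-decreasing computed rank, ties broken arbitrarily.
IsWindowSortResult : {n : ℕ} → Comparison n → Arrangement n → ℕ → Arrangement n → Set
IsWindowSortResult {n} gt σ w σ' =
  ∀ (x y : Fin n) → pos σ' x Data.Nat.< pos σ' y → computedRank gt σ w x ≤ computedRank gt σ w y
  where import Data.Nat

module Submission where

-- Write W = 2w and C(y) = computed_rank(y).  Two local facts hold for every y: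
--   (A) σ(y) ≤ C(y) + W, since C(y) ≥ σ(y) ∸ W;
--   (B) C(y) ≤ σ(y) + W, since the window of y has at most min(σ(y) − 1, W)
--       positions below σ(y) and at most W above it, so wins(y) is bounded too.
-- Because σ' lists the elements by non-decreasing C, two counting arguments finish:
--   (I)  σ'(x) ≤ C(x) + W: the σ'(x) elements y with σ'(y) ≤ σ'(x) have
--        C(y) ≤ C(x), so by (A) they sit at distinct σ-positions ≤ C(x) + W;
--   (II) C(x) ≤ σ'(x) + W: for K = C(x) ∸ (W + 1), the K elements at
--        σ-positions ≤ K have C(y) < C(x) by (B), so they all precede x in σ'.

open import Defs
open import Data.Nat using (ℕ; _≤_; _*_; ∣_-_∣)
open import Data.Fin using (Fin)

open import Data.Nat using (zero; suc; _+_; _∸_; _<_; _<?_; _≤?_; z≤n; s≤s; s≤s⁻¹)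
open import Data.Nat.Properties
open import Data.Fin using (toℕ) renaming (zero to fzero; suc to fsuc)
open import Data.Fin.Properties using (toℕ-injective; toℕ<n)
open import Data.List using (length; filter; tabulate)
open import Data.Product using (_×_; _,_; proj₁)
open import Data.Sum using (_⊎_; inj₁; inj₂)
open import Relation.Nullary using (Dec; yes; no; _×-dec_; contradiction)
open import Relation.Nullary.Decidable using (T?)
open import Relation.Unary using (Pred; Decidable; _⊆_)
open import Relation.Binary.PropositionalEquality using (_≡_; refl; sym; cong; cong₂)
open import Relation.Binary.Definitions using (tri<; tri≈; tri>)
open import Function.Bundles using (_↔_; Inverse; Injection)
open import Function.Properties.Inverse using (Inverse⇒Injection)
open import Algebra.Properties.CommutativeMonoid.Sum +-0-commutativeMonoid
  using (sum; sum-permute; ∑-distrib-+)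

indicator : ∀ {p} {P : Set p} → Dec P → ℕ
indicator (yes _) = 1
indicator (no _)  = 0

indicator-mono : ∀ {p q} {P : Set p} {Q : Set q} (P? : Dec P) (Q? : Dec Q) →
                 (P → Q) → indicator P? ≤ indicator Q?
indicator-mono (yes _) (yes _) _   = ≤-refl
indicator-mono (yes p) (no ¬q) P⇒Q = contradiction (P⇒Q p) ¬q
indicator-mono (no _)  _       _   = z≤n

indicator-⊎ : ∀ {p q r} {P : Set p} {Q : Set q} {R : Set r}
              (P? : Dec P) (Q? : Dec Q) (R? : Dec R) →
              (P → Q ⊎ R) → indicator P? ≤ indicator Q? + indicator R?
indicator-⊎ (no _)  _       _       _ = z≤n
indicator-⊎ (yes _) (yes _) _       _ = s≤s z≤n
indicator-⊎ (yes _) (no _)  (yes _) _ = ≤-refl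
indicator-⊎ (yes p) (no ¬q) (no ¬r) P⇒Q⊎R with P⇒Q⊎R p
... | inj₁ q = contradiction q ¬q
... | inj₂ r = contradiction r ¬r

sum-mono : ∀ {n} (f g : Fin n → ℕ) → (∀ i → f i ≤ g i) → sum f ≤ sum g
sum-mono {zero}  f g f≤g = z≤n
sum-mono {suc n} f g f≤g =
  +-mono-≤ (f≤g fzero) (sum-mono (λ i → f (fsuc i)) (λ i → g (fsuc i)) (λ i → f≤g (fsuc i)))

count : ∀ {n p} {P : Pred (Fin n) p} → Decidable P → ℕ
count P? = sum (λ i → indicator (P? i))

count-mono : ∀ {n p q} {P : Pred (Fin n) p} {Q : Pred (Fin n) q}
             (P? : Decidable P) (Q? : Decidable Q) → P ⊆ Q → count P? ≤ count Q?
count-mono P? Q? P⊆Q = sum-mono _ _ (λ i → indicator-mono (P? i) (Q? i) P⊆Q)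

count-⊎ : ∀ {n p q r} {P : Pred (Fin n) p} {Q : Pred (Fin n) q} {R : Pred (Fin n) r}
          (P? : Decidable P) (Q? : Decidable Q) (R? : Decidable R) →
          (∀ {i} → P i → Q i ⊎ R i) → count P? ≤ count Q? + count R?
count-⊎ P? Q? R? cover = begin
  count P?                                                ≤⟨ sum-mono _ _ (λ i → indicator-⊎ (P? i) (Q? i) (R? i) cover) ⟩
  sum (λ i → indicator (Q? i) + indicator (R? i))         ≡⟨ ∑-distrib-+ (λ i → indicator (Q? i)) (λ i → indicator (R? i)) ⟩
  count Q? + count R?                                     ∎
  where open ≤-Reasoning

count-permute : ∀ {n p} {P : Pred (Fin n) p} (π : Fin n ↔ Fin n)
                (P? : Decidable P) → count P? ≡ count (λ y → P? (Inverse.to π y))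
count-permute π P? = sum-permute (λ i → indicator (P? i)) π

length-filter-tabulate : ∀ {a p} {A : Set a} {P : Pred A p} (P? : Decidable P) {n}
                         (f : Fin n → A) →
                         length (filter P? (tabulate f)) ≡ count (λ i → P? (f i))
length-filter-tabulate P? {zero}  f = refl
length-filter-tabulate P? {suc n} f with P? (f fzero)
... | yes _ = cong suc (length-filter-tabulate P? (λ i → f (fsuc i)))
... | no _  = length-filter-tabulate P? (λ i → f (fsuc i))

Between : ℕ → ℕ → ℕ → Set
Between a b i = a ≤ i × i < b

between? : ∀ a b i → Dec (Between a b i)
between? a b i = (a ≤? i) ×-dec (i <? b)

between-pred : ∀ a b i → Between a b (suc i) → Between (a ∸ 1) (b ∸ 1) i
between-pred zero    (suc b) i (_ , s≤s i<b)         = z≤n , i<b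
between-pred (suc a) (suc b) i (s≤s a≤i , s≤s i<b)   = a≤i , i<b

between-head : ∀ a b → indicator (between? a b 0) + ((b ∸ 1) ∸ (a ∸ 1)) ≤ b ∸ a
between-head zero    zero    = z≤n
between-head zero    (suc b) = ≤-refl
between-head (suc a) b       = ≤-reflexive (∸-+-assoc b 1 a)

count-between : ∀ {n} a b → count {n} (λ i → between? a b (toℕ i)) ≤ b ∸ a
count-between {zero}  a b = z≤n
count-between {suc n} a b = begin
  indicator (between? a b 0) + count {n} (λ i → between? a b (suc (toℕ i)))
    ≤⟨ +-monoʳ-≤ _ (count-mono _ (λ (i : Fin n) → between? (a ∸ 1) (b ∸ 1) (toℕ i)) (between-pred a b _)) ⟩
  indicator (between? a b 0) + count {n} (λ i → between? (a ∸ 1) (b ∸ 1) (toℕ i))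
    ≤⟨ +-monoʳ-≤ _ (count-between {n} (a ∸ 1) (b ∸ 1)) ⟩
  indicator (between? a b 0) + ((b ∸ 1) ∸ (a ∸ 1))
    ≤⟨ between-head a b ⟩
  b ∸ a ∎
  where open ≤-Reasoning

count-below-≤ : ∀ {n} K → count {n} (λ i → toℕ i <? K) ≤ K
count-below-≤ {n} K =
  ≤-trans (count-mono _ (λ (i : Fin n) → between? 0 K (toℕ i)) (z≤n ,_)) (count-between {n} 0 K)

count-below-≥ : ∀ {n} K → K ≤ n → K ≤ count {n} (λ i → toℕ i <? K)
count-below-≥ {n}     zero    _         = z≤n
count-below-≥ {suc n} (suc K) (s≤s K≤n) = s≤s (begin
  K                                             ≤⟨ count-below-≥ K K≤n ⟩
  count {n} (λ i → toℕ i <? K)                  ≤⟨ count-mono _ (λ (i : Fin n) → suc (toℕ i) <? suc K) s≤s ⟩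
  count {n} (λ i → suc (toℕ i) <? suc K)        ∎)
  where open ≤-Reasoning

rank : ∀ {n} → Arrangement n → Fin n → ℕ
rank π y = toℕ (Inverse.to π y)

rank-injective : ∀ {n} (π : Arrangement n) {y z : Fin n} → rank π y ≡ rank π z → y ≡ z
rank-injective π eq = Injection.injective (Inverse⇒Injection π) (toℕ-injective eq)

-- Rank transfer: if every element within the first A places of π is within the
-- first B places of ρ, then A ≤ B (these A elements need A distinct places).
rank-transfer : ∀ {n} (π ρ : Arrangement n) {A B : ℕ} → A ≤ n →
                (∀ y → rank π y < A → rank ρ y < B) → A ≤ B
rank-transfer {n} π ρ {A} {B} A≤n early = begin
  A                               ≤⟨ count-below-≥ A A≤n ⟩
  count {n} (λ i → toℕ i <? A)    ≡⟨ count-permute π (λ i → toℕ i <? A) ⟩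
  count (λ y → rank π y <? A)     ≤⟨ count-mono (λ y → rank π y <? A) (λ y → rank ρ y <? B) (early _) ⟩
  count (λ y → rank ρ y <? B)     ≡⟨ sym (count-permute ρ (λ i → toℕ i <? B)) ⟩
  count {n} (λ i → toℕ i <? B)    ≤⟨ count-below-≤ {n} B ⟩
  B                               ∎
  where open ≤-Reasoning

∣m-n∣≤o : ∀ m n o → m ≤ n + o → n ≤ m + o → ∣ m - n ∣ ≤ o
∣m-n∣≤o m n o m≤n+o n≤m+o with ∣m-n∣≡[m∸n]∨[n∸m] m n
... | inj₁ eq rewrite eq = m≤n+o⇒m∸n≤o m n m≤n+o
... | inj₂ eq rewrite eq = m≤n+o⇒m∸n≤o n m n≤m+o

m<n∸o⇒o+m<n : ∀ m n o → m < n ∸ o → o + m < n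
m<n∸o⇒o+m<n m n o m<n∸o = ≰⇒> (λ n≤o+m → <⇒≱ m<n∸o (m≤n+o⇒m∸n≤o n o n≤o+m))

-- (suc q ∸ W) plus the number min(q, W) of window places below q is at most suc q.
window-arith : ∀ q W → (suc q ∸ W) + (q ∸ (q ∸ W)) ≤ suc q
window-arith q W with W ≤? q
... | yes W≤q = ≤-reflexive (begin-equality
  (suc q ∸ W) + (q ∸ (q ∸ W)) ≡⟨ cong₂ _+_ (+-∸-assoc 1 W≤q) (m∸[m∸n]≡n W≤q) ⟩
  suc (q ∸ W) + W             ≡⟨ cong suc (m∸n+n≡m W≤q) ⟩
  suc q                       ∎)
  where open ≤-Reasoning
... | no W≰q rewrite m≤n⇒m∸n≡0 (≰⇒> W≰q) | m≤n⇒m∸n≡0 (<⇒≤ (≰⇒> W≰q)) = n≤1+n q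

module _ {n : ℕ} (gt : Comparison n) (σ : Arrangement n) (w : ℕ) where

  pos≤computedRank+2w : ∀ y → pos σ y ≤ computedRank gt σ w y + 2 * w
  pos≤computedRank+2w y = begin
    pos σ y                                      ≤⟨ m≤n+m∸n (pos σ y) (2 * w) ⟩
    2 * w + (pos σ y ∸ 2 * w)                    ≡⟨ +-comm (2 * w) _ ⟩
    (pos σ y ∸ 2 * w) + 2 * w                    ≤⟨ +-monoˡ-≤ (2 * w) (m≤m+n (pos σ y ∸ 2 * w) (wins gt σ w y)) ⟩
    computedRank gt σ w y + 2 * w                ∎
    where open ≤-Reasoning

  window-split : ∀ y z → InWindow σ w y z →
                 Between (rank σ y ∸ 2 * w) (rank σ y) (rank σ z)
                   ⊎ Between (suc (rank σ y)) (suc (rank σ y) + 2 * w) (rank σ z)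
  window-split y z (z≢y , y≤z+W , z≤y+W) with <-cmp (rank σ z) (rank σ y)
  ... | tri< z<y _ _ = inj₁ (m≤n+o⇒m∸n≤o _ (2 * w) (≤-trans (s≤s⁻¹ y≤z+W) (≤-reflexive (+-comm _ (2 * w)))) , z<y)
  ... | tri≈ _ z≡y _ = contradiction (cong suc z≡y) z≢y
  ... | tri> _ _ y<z = inj₂ (y<z , z≤y+W)

  -- wins(y) is at most the number of window places: min(q, 2w) below, 2w above.
  wins-bound : ∀ y → wins gt σ w y ≤ (rank σ y ∸ (rank σ y ∸ 2 * w)) + 2 * w
  wins-bound y = begin
    wins gt σ w y
      ≡⟨ length-filter-tabulate won? (λ z → z) ⟩
    count won?
      ≤⟨ count-⊎ won? (λ z → below? (rank σ z)) (λ z → above? (rank σ z)) (λ won → window-split y _ (proj₁ won)) ⟩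
    count (λ z → below? (rank σ z)) + count (λ z → above? (rank σ z))
      ≡⟨ sym (cong₂ _+_ (count-permute σ (λ i → below? (toℕ i))) (count-permute σ (λ i → above? (toℕ i)))) ⟩
    count {n} (λ i → below? (toℕ i)) + count {n} (λ i → above? (toℕ i))
      ≤⟨ +-mono-≤ (count-between {n} (q ∸ 2 * w) q) (count-between {n} (suc q) (suc q + 2 * w)) ⟩
    (q ∸ (q ∸ 2 * w)) + ((suc q + 2 * w) ∸ suc q)
      ≡⟨ cong ((q ∸ (q ∸ 2 * w)) +_) (m+n∸m≡n (suc q) (2 * w)) ⟩
    (q ∸ (q ∸ 2 * w)) + 2 * w ∎
    where
    open ≤-Reasoning
    q = rank σ y
    won? = λ z → inWindow? σ w y z ×-dec T? (gt y z)
    below? = between? (q ∸ 2 * w) q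
    above? = between? (suc q) (suc q + 2 * w)

  computedRank≤pos+2w : ∀ y → computedRank gt σ w y ≤ pos σ y + 2 * w
  computedRank≤pos+2w y = begin
    (suc q ∸ 2 * w) + wins gt σ w y                 ≤⟨ +-monoʳ-≤ (suc q ∸ 2 * w) (wins-bound y) ⟩
    (suc q ∸ 2 * w) + ((q ∸ (q ∸ 2 * w)) + 2 * w)   ≡⟨ sym (+-assoc (suc q ∸ 2 * w) _ (2 * w)) ⟩
    (suc q ∸ 2 * w) + (q ∸ (q ∸ 2 * w)) + 2 * w     ≤⟨ +-monoˡ-≤ (2 * w) (window-arith q (2 * w)) ⟩
    suc q + 2 * w                                   ∎
    where
    open ≤-Reasoning
    q = rank σ y

  module _ (σ' : Arrangement n) (sorted : IsWindowSortResult gt σ w σ') where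

    placed-before⇒computedRank≤ : ∀ x y → rank σ' y ≤ rank σ' x →
                                  computedRank gt σ w y ≤ computedRank gt σ w x
    placed-before⇒computedRank≤ x y y≤x with m≤n⇒m<n∨m≡n y≤x
    ... | inj₁ y<x = sorted y x (s≤s y<x)
    ... | inj₂ y≡x = ≤-reflexive (cong (computedRank gt σ w) (rank-injective σ' y≡x))

    computedRank<⇒placed-before : ∀ x y → computedRank gt σ w y < computedRank gt σ w x →
                                  rank σ' y < rank σ' x
    computedRank<⇒placed-before x y Cy<Cx =
      ≰⇒> (λ x≤y → <⇒≱ Cy<Cx (placed-before⇒computedRank≤ y x x≤y))

mainTheorem11 : (n : ℕ) (gt : Comparison n) → Consistent gt →
                (σ : Arrangement n) (w : ℕ) (σ' : Arrangement n) →
                IsWindowSortResult gt σ w σ' →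
                (x : Fin n) → ∣ computedRank gt σ w x - pos σ' x ∣ ≤ 2 * w
mainTheorem11 n gt _ σ w σ' sorted x = ∣m-n∣≤o (C x) (pos σ' x) W C≤pos'+W pos'≤C+W
  where
  W = 2 * w
  C = computedRank gt σ w
  K = C x ∸ suc W

  -- (I): the first σ'(x) elements of σ' all lie within the first C(x) + W places of σ.
  pos'≤C+W : pos σ' x ≤ C x + W
  pos'≤C+W = rank-transfer σ' σ (toℕ<n (Inverse.to σ' x)) λ y y≤x →
    ≤-trans (pos≤computedRank+2w gt σ w y)
            (+-monoˡ-≤ W (placed-before⇒computedRank≤ gt σ w σ' sorted x y (s≤s⁻¹ y≤x)))

  C≤1+W+rank : ∀ y → C y ≤ suc W + rank σ y
  C≤1+W+rank y = ≤-trans (computedRank≤pos+2w gt σ w y) (≤-reflexive (cong suc (+-comm (rank σ y) W)))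

  -- (II): the first K elements of σ all have C(y) < C(x), hence precede x in σ'.
  K≤rank : K ≤ rank σ' x
  K≤rank = rank-transfer σ σ' K≤n λ y y<K →
    computedRank<⇒placed-before gt σ w σ' sorted x y
      (≤-<-trans (C≤1+W+rank y) (m<n∸o⇒o+m<n (rank σ y) (C x) (suc W) y<K))
    where
    K≤n : K ≤ n
    K≤n = ≤-trans (m≤n+o⇒m∸n≤o (C x) (suc W) (C≤1+W+rank x)) (<⇒≤ (toℕ<n (Inverse.to σ x)))

  C≤pos'+W : C x ≤ pos σ' x + W
  C≤pos'+W = begin
    C x                  ≤⟨ m≤n+m∸n (C x) (suc W) ⟩
    suc W + K            ≤⟨ +-monoʳ-≤ (suc W) K≤rank ⟩
    suc W + rank σ' x    ≡⟨ cong suc (+-comm W (rank σ' x)) ⟩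
    pos σ' x + W         ∎
    where open ≤-Reasoning
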